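{- For all $l,m,n\in\mathbb{Z}_{\geq 0}$, \[ \sum_{j=0}^{n} {n \brack j} B_{m}^{(-l-j)}(n) = \sum_{j=0}^{n} {n \brack j} B_{l}^{(-m-j)}(n). \]
   Context: For $k\in\mathbb{Z}$ let $\mathrm{Li}_k(z)=\sum_{m\ge1} z^m/m^k$ (for $k\le 0$ this is a rational function of $z$). The poly-Bernoulli polynomials $B_n^{(k)}(x)$ ($k\in\mathbb{Z}$, $n\ge0$) are defined by $e^{ -xt}\frac{\mathrm{Li}_k(1-e^{ -t})}{1-e^{ -t}}=\sum_{n\ge0}B_n^{(k)}(x)\frac{t^n}{n!}$. The Stirling numbers of the first kind ${n \brack j}$ are defined by ${0\brack 0}=1$, ${n\brack 0}={0\brack m}=0$ for $m,n\neq0$, and ${n+1\brack m}={n\brack m-1}+n{n\brack m}$ for $n\ge0,m\ge1$. -}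

module Defs where

open import Data.Nat using (ℕ; zero; suc; _∸_)
open import Data.Nat.Combinatorics using (_C_)
open import Data.Integer using (ℤ; +_; -_; _+_; _*_; _^_)

sumTo : ℕ → (ℕ → ℤ) → ℤ
sumTo zero    f = f 0
sumTo (suc n) f = sumTo n f + f (suc n)

stirling1 : ℕ → ℕ → ℕ
stirling1 zero    zero    = 1
stirling1 zero    (suc m) = 0
stirling1 (suc n) zero    = 0
stirling1 (suc n) (suc m) = stirling1 n m Data.Nat.+ n Data.Nat.* stirling1 n (suc m)

-- Exponential generating functions are represented by their sequences a
-- with F(t) = Σ a n t^n / n!.  Product of EGFs:
egfMul : (ℕ → ℤ) → (ℕ → ℤ) → ℕ → ℤ
egfMul a b n = sumTo n (λ i → + (n C i) * a i * b (n ∸ i))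

expNeg : ℤ → ℕ → ℤ
expNeg x n = (- x) ^ n

oneMinusExpNeg : ℕ → ℤ
oneMinusExpNeg zero    = + 0
oneMinusExpNeg (suc n) = - ((- (+ 1)) ^ suc n)

egfPow : (ℕ → ℤ) → ℕ → ℕ → ℤ
egfPow a zero    zero    = + 1
egfPow a zero    (suc n) = + 0
egfPow a (suc m) n       = egfMul a (egfPow a m) n

-- Li_{-k}(z)/z = Σ_{m≥1} m^k z^{m-1}, composed with z = 1 - e^{-t}.
-- Since 1 - e^{-t} has zero constant term, only m-1 ≤ n contributes
-- to the coefficient of t^n/n!.
liOverZ : ℕ → ℕ → ℤ
liOverZ k n = sumTo n (λ i → (+ suc i) ^ k * egfPow oneMinusExpNeg i n)

-- polyBernoulliNeg k n x = B_n^{(-k)}(x), i.e. n! [t^n] of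
-- e^{-xt} Li_{-k}(1-e^{-t}) / (1-e^{-t}), evaluated at an integer x
-- (for nonpositive index these are integer-coefficient polynomials).
polyBernoulliNeg : ℕ → ℕ → ℤ → ℤ
polyBernoulliNeg k n x = egfMul (expNeg x) (liOverZ k) n

-- Write E q s = q!·S(s+1,q+1) (S the Stirling numbers of the second kind), so that the egf of
-- s ↦ E q s is e^t (e^t − 1)^q.  Kaneko's formula B_s^(−k)(0) = Σ_q E q k · E q s, multiplied by
-- e^{−xt}, gives B_m^(−k)(x) = Σ_q E q k · P_x(m,q), where P_x(·,q) has egf e^{(1−x)t} (e^t − 1)^q.
-- Hence the left-hand side is Σ_q U_l(q) · P_n(m,q) with U_l(q) = Σ_j [n,j] E q (l+j).  Like E,
-- U obeys U_{l+1}(q) = (q+1) U_l(q) + q U_l(q−1); moving this recurrence onto an arbitrary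
-- sequence W and inducting on l gives Σ_q U_l(q) W(q) = Σ_k E k l · (k+1)⋯(k+n) · Σ_c C(n,c) W(k+c),
-- since E obeys the same recurrence in l and n! C(n,q) = U_0(q).  For W = P_n(m,·)
-- the inner binomial sum is E k m, because e^{−nt} (1 + (e^t − 1))^n = 1.  The result,
-- Σ_k (k+1)⋯(k+n) · E k l · E k m, is symmetric in l and m.
module Submission where

open import Defs
open import Data.Nat using (ℕ)
open import Data.Nat as ℕ using (zero; suc; pred; _≤_; _<_; _≤′_; _∸_; z≤n; s≤s)
import Data.Nat.Properties as ℕ
open import Data.Nat.Combinatorics using (_C_; nCk+nC[k+1]≡[n+1]C[k+1])
open import Data.Integer as ℤ using (ℤ; 0ℤ; +_; -_; _+_; _-_; _*_; _^_)
import Data.Integer.Properties as ℤ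
open import Data.Integer.Tactic.RingSolver using (solve-∀)
open import Data.Sum using (inj₁; inj₂)
open import Relation.Binary.PropositionalEquality
  using (_≡_; refl; sym; trans; cong; cong₂; module ≡-Reasoning)

open ≡-Reasoning

-- Finite sums

sumTo-cong : ∀ n {f g : ℕ → ℤ} → (∀ i → i ≤ n → f i ≡ g i) → sumTo n f ≡ sumTo n g
sumTo-cong zero    f≗g = f≗g 0 z≤n
sumTo-cong (suc n) f≗g =
  cong₂ _+_ (sumTo-cong n (λ i i≤n → f≗g i (ℕ.m≤n⇒m≤1+n i≤n))) (f≗g (suc n) ℕ.≤-refl)

sumTo-+ : ∀ n (f g : ℕ → ℤ) → sumTo n (λ i → f i + g i) ≡ sumTo n f + sumTo n g
sumTo-+ zero    f g = refl
sumTo-+ (suc n) f g =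
  trans (cong (_+ (f (suc n) + g (suc n))) (sumTo-+ n f g))
        (interchange (sumTo n f) (sumTo n g) (f (suc n)) (g (suc n)))
  where
  interchange : ∀ a b c d → (a + b) + (c + d) ≡ (a + c) + (b + d)
  interchange = solve-∀

sumTo-*ˡ : ∀ n c (f : ℕ → ℤ) → sumTo n (λ i → c * f i) ≡ c * sumTo n f
sumTo-*ˡ zero    c f = refl
sumTo-*ˡ (suc n) c f =
  trans (cong (_+ c * f (suc n)) (sumTo-*ˡ n c f)) (sym (ℤ.*-distribˡ-+ c _ _))

sumTo-*ʳ : ∀ n c (f : ℕ → ℤ) → sumTo n (λ i → f i * c) ≡ sumTo n f * c
sumTo-*ʳ n c f =
  trans (sumTo-cong n (λ i _ → ℤ.*-comm (f i) c)) (trans (sumTo-*ˡ n c f) (ℤ.*-comm c _))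

sumTo-- : ∀ n (f g : ℕ → ℤ) → sumTo n (λ i → f i - g i) ≡ sumTo n f - sumTo n g
sumTo-- zero    f g = refl
sumTo-- (suc n) f g =
  trans (cong (_+ (f (suc n) - g (suc n))) (sumTo-- n f g))
        (interchange (sumTo n f) (sumTo n g) (f (suc n)) (g (suc n)))
  where
  interchange : ∀ a b c d → (a - b) + (c - d) ≡ (a + c) - (b + d)
  interchange = solve-∀

sumTo-linear : ∀ n a b (f g : ℕ → ℤ) →
  sumTo n (λ i → a * f i + b * g i) ≡ a * sumTo n f + b * sumTo n g
sumTo-linear n a b f g =
  trans (sumTo-+ n _ _) (cong₂ _+_ (sumTo-*ˡ n a f) (sumTo-*ˡ n b g))

sumTo-zero : ∀ n (f : ℕ → ℤ) → (∀ i → i ≤ n → f i ≡ 0ℤ) → sumTo n f ≡ 0ℤ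
sumTo-zero zero    f f≡0 = f≡0 0 z≤n
sumTo-zero (suc n) f f≡0 =
  cong₂ _+_ (sumTo-zero n f (λ i i≤n → f≡0 i (ℕ.m≤n⇒m≤1+n i≤n))) (f≡0 (suc n) ℕ.≤-refl)

sumTo-suc : ∀ n (f : ℕ → ℤ) → sumTo (suc n) f ≡ f 0 + sumTo n (λ i → f (suc i))
sumTo-suc zero    f = refl
sumTo-suc (suc n) f = trans (cong (_+ f (suc (suc n))) (sumTo-suc n f)) (ℤ.+-assoc (f 0) _ _)

sumTo-shift : ∀ n (f : ℕ → ℤ) → f (suc n) ≡ 0ℤ → sumTo n f ≡ f 0 + sumTo n (λ i → f (suc i))
sumTo-shift n f fn+1≡0 =
  trans (sym (trans (cong (_+_ (sumTo n f)) fn+1≡0) (ℤ.+-identityʳ _))) (sumTo-suc n f)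

sumTo-extend : ∀ {a b} (f : ℕ → ℤ) → a ≤ b → (∀ i → a < i → f i ≡ 0ℤ) → sumTo b f ≡ sumTo a f
sumTo-extend {a} f a≤b f≡0 = go (ℕ.≤⇒≤′ a≤b)
  where
  go : ∀ {b} → a ≤′ b → sumTo b f ≡ sumTo a f
  go ℕ.≤′-refl = refl
  go (ℕ.≤′-step {b} a≤′b) =
    trans (cong₂ _+_ (go a≤′b) (f≡0 (suc b) (s≤s (ℕ.≤′⇒≤ a≤′b)))) (ℤ.+-identityʳ _)

sumTo-comm : ∀ a b (f : ℕ → ℕ → ℤ) →
  sumTo a (λ i → sumTo b (f i)) ≡ sumTo b (λ j → sumTo a (λ i → f i j))
sumTo-comm zero    b f = refl
sumTo-comm (suc a) b f =
  trans (cong (_+ sumTo b (f (suc a))) (sumTo-comm a b f))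
        (sym (sumTo-+ b (λ j → sumTo a (λ i → f i j)) (f (suc a))))

δ : ℕ → ℤ
δ zero    = + 1
δ (suc _) = 0ℤ

sumTo-δ : ∀ n (f : ℕ → ℤ) → sumTo n (λ k → δ k * f k) ≡ f 0
sumTo-δ zero    f = ℤ.*-identityˡ (f 0)
sumTo-δ (suc n) f = trans (ℤ.+-identityʳ _) (sumTo-δ n f)

-- Binomial coefficients and the operators 𝒟, 𝒟ᵀ

binomial : ℕ → ℕ → ℤ
binomial n       zero    = + 1
binomial zero    (suc k) = 0ℤ
binomial (suc n) (suc k) = binomial n k + binomial n (suc k)

C≡binomial : ∀ n k → + (n C k) ≡ binomial n k
C≡binomial n       zero    = refl
C≡binomial zero    (suc k) = refl
C≡binomial (suc n) (suc k) =
  trans (cong +_ (sym (nCk+nC[k+1]≡[n+1]C[k+1] n k)))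
        (cong₂ _+_ (C≡binomial n k) (C≡binomial n (suc k)))

binomial-vanish : ∀ {n k} → n < k → binomial n k ≡ 0ℤ
binomial-vanish {zero}  {suc k} _ = refl
binomial-vanish {suc n} {suc k} (s≤s n<k) =
  cong₂ _+_ (binomial-vanish n<k) (binomial-vanish (ℕ.m≤n⇒m≤1+n n<k))

-- The term q * g (pred q) vanishes at q = 0, so the junk value pred 0 = 0 is harmless.
𝒟 : (ℕ → ℤ) → ℕ → ℤ
𝒟 g q = + suc q * g q + + q * g (pred q)

𝒟ᵀ : (ℕ → ℤ) → ℕ → ℤ
𝒟ᵀ W q = + suc q * (W q + W (suc q))

𝒟-cong : ∀ {g h : ℕ → ℤ} → (∀ q → g q ≡ h q) → ∀ q → 𝒟 g q ≡ 𝒟 h q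
𝒟-cong g≗h q = cong₂ (λ a b → + suc q * a + + q * b) (g≗h q) (g≗h (pred q))

sumTo-𝒟-adjoint : ∀ M (g W : ℕ → ℤ) → g M * W (suc M) ≡ 0ℤ →
  sumTo M (λ q → 𝒟 g q * W q) ≡ sumTo M (λ q → g q * 𝒟ᵀ W q)
sumTo-𝒟-adjoint M g W boundary = begin
  sumTo M (λ q → 𝒟 g q * W q)
    ≡⟨ sumTo-cong M (λ q _ → ℤ.*-distribʳ-+ (W q) (+ suc q * g q) (+ q * g (pred q))) ⟩
  sumTo M (λ q → + suc q * g q * W q + + q * g (pred q) * W q)
    ≡⟨ sumTo-+ M _ _ ⟩
  sumTo M (λ q → + suc q * g q * W q) + sumTo M (λ q → + q * g (pred q) * W q)
    ≡⟨ cong (_+_ (sumTo M _)) (trans (sumTo-shift M _ top≡0) (ℤ.+-identityˡ _)) ⟩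
  sumTo M (λ q → + suc q * g q * W q) + sumTo M (λ q → + suc q * g q * W (suc q))
    ≡⟨ sym (sumTo-+ M _ _) ⟩
  sumTo M (λ q → + suc q * g q * W q + + suc q * g q * W (suc q))
    ≡⟨ sumTo-cong M (λ q _ → collect (+ suc q) (g q) (W q) (W (suc q))) ⟩
  sumTo M (λ q → g q * 𝒟ᵀ W q) ∎
  where
  collect : ∀ k a w w′ → k * a * w + k * a * w′ ≡ a * (k * (w + w′))
  collect = solve-∀
  top≡0 : + suc M * g M * W (suc M) ≡ 0ℤ
  top≡0 = trans (ℤ.*-assoc (+ suc M) (g M) _) (trans (cong (_*_ (+ suc M)) boundary) (ℤ.*-zeroʳ (+ suc M)))

𝒟ᵀ-binomial : ∀ n q → 𝒟ᵀ (binomial n) q ≡ + suc n * binomial n q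
𝒟ᵀ-binomial zero    zero    = refl
𝒟ᵀ-binomial zero    (suc q) = ℤ.*-zeroʳ (+ suc (suc q))
𝒟ᵀ-binomial (suc n) zero    = begin
  + 1 * (+ 1 + (+ 1 + binomial n 1)) ≡⟨ peel (binomial n 1) ⟩
  + 1 + + 1 * (+ 1 + binomial n 1)   ≡⟨ cong (_+_ (+ 1)) (𝒟ᵀ-binomial n zero) ⟩
  + 1 + + suc n * + 1                ≡⟨ collect (+ suc n) ⟩
  + suc (suc n) * + 1                ∎
  where
  peel : ∀ b → + 1 * (+ 1 + (+ 1 + b)) ≡ + 1 + + 1 * (+ 1 + b)
  peel = solve-∀
  collect : ∀ N → + 1 + N * + 1 ≡ (+ 1 + N) * + 1
  collect = solve-∀
𝒟ᵀ-binomial (suc n) (suc q) = begin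
  (+ 1 + Q) * ((A + B) + Y)           ≡⟨ expand (A + B) Y Q ⟩
  (A + B) + Q * (A + B) + (+ 1 + Q) * Y
    ≡⟨ cong₂ (λ a b → (A + B) + a + b) (𝒟ᵀ-binomial n q) (𝒟ᵀ-binomial n (suc q)) ⟩
  (A + B) + N * A + N * B             ≡⟨ collect A B N ⟩
  (+ 1 + N) * (A + B)                 ∎
  where
  A = binomial n q
  B = binomial n (suc q)
  Y = binomial (suc n) (suc (suc q))
  Q = + suc q
  N = + suc n
  expand : ∀ X Y Q → (+ 1 + Q) * (X + Y) ≡ X + Q * X + (+ 1 + Q) * Y
  expand = solve-∀
  collect : ∀ A B N → (A + B) + N * A + N * B ≡ (+ 1 + N) * (A + B)
  collect = solve-∀

suc-*-binomial-suc : ∀ n c → + suc c * binomial n (suc c) ≡ (+ n - + c) * binomial n c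
suc-*-binomial-suc n c = begin
  (+ 1 + C) * B                   ≡⟨ split A B C ⟩
  (+ 1 + C) * (A + B) - (+ 1 + C) * A ≡⟨ cong (_- (+ 1 + C) * A) (𝒟ᵀ-binomial n c) ⟩
  (+ 1 + N) * A - (+ 1 + C) * A   ≡⟨ collect A N C ⟩
  (N - C) * A                     ∎
  where
  A = binomial n c
  B = binomial n (suc c)
  C = + c
  N = + n
  split : ∀ A B C → (+ 1 + C) * B ≡ (+ 1 + C) * (A + B) - (+ 1 + C) * A
  split = solve-∀
  collect : ∀ A N C → (+ 1 + N) * A - (+ 1 + C) * A ≡ (N - C) * A
  collect = solve-∀

𝒟-binomial : ∀ n q → 𝒟 (binomial n) q + + n * binomial n q ≡ + suc n * binomial (suc n) q
𝒟-binomial n zero    = collect (+ n)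
  where
  collect : ∀ N → + 1 + N * + 1 ≡ (+ 1 + N) * + 1
  collect = solve-∀
𝒟-binomial n (suc q) = begin
  (+ 1 + Q) * B + Q * A + N * B  ≡⟨ regroup A B Q N ⟩
  Q * (A + B) + (+ 1 + N) * B    ≡⟨ cong (_+ (+ 1 + N) * B) (𝒟ᵀ-binomial n q) ⟩
  (+ 1 + N) * A + (+ 1 + N) * B  ≡⟨ sym (ℤ.*-distribˡ-+ (+ 1 + N) A B) ⟩
  (+ 1 + N) * (A + B)            ∎
  where
  A = binomial n q
  B = binomial n (suc q)
  Q = + suc q
  N = + n
  regroup : ∀ A B Q N → (+ 1 + Q) * B + Q * A + N * B ≡ Q * (A + B) + (+ 1 + N) * B
  regroup = solve-∀

sumTo-*-binomial : ∀ n (f : ℕ → ℤ) →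
  sumTo n (λ c → + c * binomial n c * f c) ≡ sumTo n (λ c → (+ n - + c) * binomial n c * f (suc c))
sumTo-*-binomial n f = begin
  sumTo n (λ c → + c * binomial n c * f c)
    ≡⟨ trans (sumTo-shift n _ top≡0) (ℤ.+-identityˡ _) ⟩
  sumTo n (λ c → + suc c * binomial n (suc c) * f (suc c))
    ≡⟨ sumTo-cong n (λ c _ → cong (_* f (suc c)) (suc-*-binomial-suc n c)) ⟩
  sumTo n (λ c → (+ n - + c) * binomial n c * f (suc c)) ∎
  where
  top≡0 : + suc n * binomial n (suc n) * f (suc n) ≡ 0ℤ
  top≡0 = cong (_* f (suc n)) (trans (cong (_*_ (+ suc n)) (binomial-vanish {n} ℕ.≤-refl)) (ℤ.*-zeroʳ (+ suc n)))

sumTo-*-binomial-absorb : ∀ n (f g : ℕ → ℤ) → (∀ c → f (suc c) ≡ g c) →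
  sumTo n (λ c → + c * binomial n c * (f c + g c)) ≡ + n * sumTo n (λ c → binomial n c * g c)
sumTo-*-binomial-absorb n f g f∘suc≗g = begin
  sumTo n (λ c → + c * binomial n c * (f c + g c))
    ≡⟨ sumTo-cong n (λ c _ → ℤ.*-distribˡ-+ (+ c * binomial n c) (f c) (g c)) ⟩
  sumTo n (λ c → + c * binomial n c * f c + + c * binomial n c * g c)
    ≡⟨ sumTo-+ n _ _ ⟩
  sumTo n (λ c → + c * binomial n c * f c) + sumTo n (λ c → + c * binomial n c * g c)
    ≡⟨ cong (_+ sumTo n (λ c → + c * binomial n c * g c)) (sumTo-*-binomial n f) ⟩
  sumTo n (λ c → (+ n - + c) * binomial n c * f (suc c)) + sumTo n (λ c → + c * binomial n c * g c)
    ≡⟨ sym (sumTo-+ n _ _) ⟩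
  sumTo n (λ c → (+ n - + c) * binomial n c * f (suc c) + + c * binomial n c * g c)
    ≡⟨ sumTo-cong n (λ c _ → trans (cong (λ y → (+ n - + c) * binomial n c * y + + c * binomial n c * g c)
                                          (f∘suc≗g c))
                                    (collect (+ n) (+ c) (binomial n c) (g c))) ⟩
  sumTo n (λ c → + n * (binomial n c * g c))
    ≡⟨ sumTo-*ˡ n (+ n) _ ⟩
  + n * sumTo n (λ c → binomial n c * g c) ∎
  where
  collect : ∀ N C B y → (N - C) * B * y + C * B * y ≡ N * (B * y)
  collect = solve-∀

-- facStirling2 q s = q! · S(s+1, q+1).
facStirling2 : ℕ → ℕ → ℤ
facStirling2 q zero    = δ q
facStirling2 q (suc s) = 𝒟 (λ p → facStirling2 p s) q

facStirling2-vanish : ∀ {q s} → s < q → facStirling2 q s ≡ 0ℤ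
facStirling2-vanish {suc q} {zero}  _         = refl
facStirling2-vanish {suc q} {suc s} (s≤s s<q) = begin
  + suc (suc q) * facStirling2 (suc q) s + + suc q * facStirling2 q s
    ≡⟨ cong₂ (λ a b → + suc (suc q) * a + + suc q * b)
             (facStirling2-vanish (ℕ.m≤n⇒m≤1+n s<q)) (facStirling2-vanish s<q) ⟩
  + suc (suc q) * 0ℤ + + suc q * 0ℤ
    ≡⟨ cong₂ _+_ (ℤ.*-zeroʳ (+ suc (suc q))) (ℤ.*-zeroʳ (+ suc q)) ⟩
  0ℤ ∎

-- Exponential generating functions

egfMul-binomial : ∀ a b n → egfMul a b n ≡ sumTo n (λ i → binomial n i * a i * b (n ∸ i))
egfMul-binomial a b n = sumTo-cong n (λ i _ → cong (λ c → c * a i * b (n ∸ i)) (C≡binomial n i))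

egfMul-congʳ : ∀ a {b b′ : ℕ → ℤ} n → (∀ s → s ≤ n → b s ≡ b′ s) → egfMul a b n ≡ egfMul a b′ n
egfMul-congʳ a n b≗b′ =
  sumTo-cong n (λ i _ → cong (_*_ (+ (n C i) * a i)) (b≗b′ (n ∸ i) (ℕ.m∸n≤m n i)))

egfMul-linearˡ : ∀ u v (a₁ a₂ : ℕ → ℤ) {a} b n → (∀ i → a i ≡ u * a₁ i + v * a₂ i) →
  egfMul a b n ≡ u * egfMul a₁ b n + v * egfMul a₂ b n
egfMul-linearˡ u v a₁ a₂ b n a≗ = trans
  (sumTo-cong n (λ i _ → trans (cong (λ x → + (n C i) * x * b (n ∸ i)) (a≗ i))
                               (spread (+ (n C i)) u (a₁ i) v (a₂ i) (b (n ∸ i)))))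
  (sumTo-linear n u v _ _)
  where
  spread : ∀ K u x v y z → K * (u * x + v * y) * z ≡ u * (K * x * z) + v * (K * y * z)
  spread = solve-∀

egfMul-linearʳ : ∀ u v a (b₁ b₂ : ℕ → ℤ) {b} n → (∀ s → b s ≡ u * b₁ s + v * b₂ s) →
  egfMul a b n ≡ u * egfMul a b₁ n + v * egfMul a b₂ n
egfMul-linearʳ u v a b₁ b₂ n b≗ = trans
  (sumTo-cong n (λ i _ → trans (cong (_*_ (+ (n C i) * a i)) (b≗ (n ∸ i)))
                               (spread (+ (n C i) * a i) u (b₁ (n ∸ i)) v (b₂ (n ∸ i)))))
  (sumTo-linear n u v _ _)
  where
  spread : ∀ K u x v y → K * (u * x + v * y) ≡ u * (K * x) + v * (K * y)
  spread = solve-∀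

egfMul-*ˡ : ∀ c a b n → egfMul (λ i → c * a i) b n ≡ c * egfMul a b n
egfMul-*ˡ c a b n = trans
  (sumTo-cong n (λ i _ → shuffle (+ (n C i)) c (a i) (b (n ∸ i))))
  (sumTo-*ˡ n c _)
  where
  shuffle : ∀ K c x y → K * (c * x) * y ≡ c * (K * x * y)
  shuffle = solve-∀

egfMul-δˡ : ∀ b n → egfMul δ b n ≡ b n
egfMul-δˡ b zero    = ℤ.*-identityˡ (b 0)
egfMul-δˡ b (suc n) = begin
  egfMul δ b (suc n)
    ≡⟨ sumTo-suc n _ ⟩
  + 1 * b (suc n) + sumTo n (λ i → + (suc n C suc i) * 0ℤ * b (n ∸ i))
    ≡⟨ cong₂ _+_ (ℤ.*-identityˡ (b (suc n)))
                 (sumTo-zero n _ (λ i _ → cong (_* b (n ∸ i)) (ℤ.*-zeroʳ (+ (suc n C suc i))))) ⟩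
  b (suc n) + 0ℤ
    ≡⟨ ℤ.+-identityʳ (b (suc n)) ⟩
  b (suc n) ∎

egfMul-sumToʳ : ∀ a M (c : ℕ → ℤ) (f : ℕ → ℕ → ℤ) n →
  egfMul a (λ s → sumTo M (λ q → c q * f q s)) n ≡ sumTo M (λ q → c q * egfMul a (f q) n)
egfMul-sumToʳ a M c f n = begin
  sumTo n (λ i → K i * sumTo M (λ q → c q * f q (n ∸ i)))
    ≡⟨ sumTo-cong n (λ i _ → sym (sumTo-*ˡ M (K i) _)) ⟩
  sumTo n (λ i → sumTo M (λ q → K i * (c q * f q (n ∸ i))))
    ≡⟨ sumTo-comm n M _ ⟩
  sumTo M (λ q → sumTo n (λ i → K i * (c q * f q (n ∸ i))))
    ≡⟨ sumTo-cong M (λ q _ → trans (sumTo-cong n (λ i _ → shuffle (K i) (c q) (f q (n ∸ i))))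
                                    (sumTo-*ˡ n (c q) _)) ⟩
  sumTo M (λ q → c q * egfMul a (f q) n) ∎
  where
  K : ℕ → ℤ
  K i = + (n C i) * a i
  shuffle : ∀ K c y → K * (c * y) ≡ c * (K * y)
  shuffle = solve-∀

egfMul-suc : ∀ a b m → egfMul a b (suc m) ≡ egfMul (λ i → a (suc i)) b m + egfMul a (λ i → b (suc i)) m
egfMul-suc a b m = begin
  egfMul a b (suc m)
    ≡⟨ trans (egfMul-binomial a b (suc m)) (sumTo-suc m _) ⟩
  X + sumTo m (λ i → (binomial m i + binomial m (suc i)) * a (suc i) * b (m ∸ i))
    ≡⟨ cong (_+_ X) (trans (sumTo-cong m (λ i _ → pascal i)) (sumTo-+ m _ _)) ⟩
  X + (sumTo m (λ i → binomial m i * a (suc i) * b (m ∸ i)) + Rest)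
    ≡⟨ swap X (sumTo m (λ i → binomial m i * a (suc i) * b (m ∸ i))) Rest ⟩
  sumTo m (λ i → binomial m i * a (suc i) * b (m ∸ i)) + (X + Rest)
    ≡⟨ cong₂ _+_ (sym (egfMul-binomial (λ i → a (suc i)) b m)) (sym derivativeʳ) ⟩
  egfMul (λ i → a (suc i)) b m + egfMul a (λ i → b (suc i)) m ∎
  where
  X = + 1 * a 0 * b (suc m)
  Rest = sumTo m (λ i → binomial m (suc i) * a (suc i) * b (m ∸ i))
  swap : ∀ x y z → x + (y + z) ≡ y + (x + z)
  swap = solve-∀
  pascal : ∀ i → (binomial m i + binomial m (suc i)) * a (suc i) * b (m ∸ i)
               ≡ binomial m i * a (suc i) * b (m ∸ i) + binomial m (suc i) * a (suc i) * b (m ∸ i)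
  pascal i = trans (cong (_* b (m ∸ i)) (ℤ.*-distribʳ-+ (a (suc i)) (binomial m i) _))
                   (ℤ.*-distribʳ-+ (b (m ∸ i)) (binomial m i * a (suc i)) (binomial m (suc i) * a (suc i)))
  aligned : ∀ i → i ≤ m → binomial m (suc i) * a (suc i) * b (suc (m ∸ suc i))
                        ≡ binomial m (suc i) * a (suc i) * b (m ∸ i)
  aligned i i≤m with ℕ.m≤n⇒m<n∨m≡n i≤m
  ... | inj₁ i<m  = cong (λ j → binomial m (suc i) * a (suc i) * b j) (sym (ℕ.+-∸-assoc 1 i<m))
  ... | inj₂ refl rewrite binomial-vanish {i} {suc i} ℕ.≤-refl = refl
  derivativeʳ : egfMul a (λ i → b (suc i)) m ≡ X + Rest
  derivativeʳ = begin
    egfMul a (λ i → b (suc i)) m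
      ≡⟨ egfMul-binomial a (λ i → b (suc i)) m ⟩
    sumTo m (λ i → binomial m i * a i * b (suc (m ∸ i)))
      ≡⟨ sumTo-shift m _ (cong (λ c → c * a (suc m) * b (suc (m ∸ suc m))) (binomial-vanish {m} ℕ.≤-refl)) ⟩
    X + sumTo m (λ i → binomial m (suc i) * a (suc i) * b (suc (m ∸ suc i)))
      ≡⟨ cong (_+_ X) (sumTo-cong m aligned) ⟩
    X + Rest ∎

oneMinusExpNeg-suc : ∀ t → oneMinusExpNeg (suc t) ≡ δ t - oneMinusExpNeg t
oneMinusExpNeg-suc zero    = refl
oneMinusExpNeg-suc (suc t) = negate ((- + 1) ^ suc t)
  where
  negate : ∀ x → - (- + 1 * x) ≡ 0ℤ - - x
  negate = solve-∀

powOneMinusExpNeg : ℕ → ℕ → ℤ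
powOneMinusExpNeg = egfPow oneMinusExpNeg

powOneMinusExpNeg-suc : ∀ i t →
  powOneMinusExpNeg i (suc t) ≡ + i * (powOneMinusExpNeg (pred i) t - powOneMinusExpNeg i t)
powOneMinusExpNeg-suc zero    t = refl
powOneMinusExpNeg-suc (suc i) t = begin
  egfMul oneMinusExpNeg (P i) (suc t)
    ≡⟨ egfMul-suc oneMinusExpNeg (P i) t ⟩
  egfMul (λ j → oneMinusExpNeg (suc j)) (P i) t + egfMul oneMinusExpNeg (λ j → P i (suc j)) t
    ≡⟨ cong₂ _+_
         (egfMul-linearˡ (+ 1) (- + 1) δ oneMinusExpNeg (P i) t
            (λ j → trans (oneMinusExpNeg-suc j) (asDifference (δ j) (oneMinusExpNeg j))))
         (egfMul-linearʳ (+ i) (- + i) oneMinusExpNeg (P (pred i)) (P i) t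
            (λ j → trans (powOneMinusExpNeg-suc i j) (asCombination (+ i) (P (pred i) j) (P i j)))) ⟩
  (+ 1 * egfMul δ (P i) t + - + 1 * P (suc i) t)
    + (+ i * egfMul oneMinusExpNeg (P (pred i)) t + - + i * P (suc i) t)
    ≡⟨ cong₂ (λ x y → (+ 1 * x + - + 1 * P (suc i) t) + (y + - + i * P (suc i) t))
             (egfMul-δˡ (P i) t) (lowered i) ⟩
  (+ 1 * P i t + - + 1 * P (suc i) t) + (+ i * P i t + - + i * P (suc i) t)
    ≡⟨ collect (+ i) (P i t) (P (suc i) t) ⟩
  (+ 1 + + i) * (P i t - P (suc i) t) ∎
  where
  P = powOneMinusExpNeg
  asCombination : ∀ c x y → c * (x - y) ≡ c * x + - c * y
  asCombination = solve-∀
  asDifference : ∀ x y → x - y ≡ + 1 * x + - + 1 * y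
  asDifference = solve-∀
  collect : ∀ I x y → (+ 1 * x + - + 1 * y) + (I * x + - I * y) ≡ (+ 1 + I) * (x - y)
  collect = solve-∀
  lowered : ∀ i → + i * egfMul oneMinusExpNeg (P (pred i)) t ≡ + i * P i t
  lowered zero    = refl
  lowered (suc i) = refl

powOneMinusExpNeg-vanish : ∀ {i s} → s < i → powOneMinusExpNeg i s ≡ 0ℤ
powOneMinusExpNeg-vanish {suc i} {zero}  _         = refl
powOneMinusExpNeg-vanish {suc i} {suc s} (s≤s s<i) = begin
  powOneMinusExpNeg (suc i) (suc s)
    ≡⟨ powOneMinusExpNeg-suc (suc i) s ⟩
  + suc i * (powOneMinusExpNeg i s - powOneMinusExpNeg (suc i) s)
    ≡⟨ cong₂ (λ x y → + suc i * (x - y))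
             (powOneMinusExpNeg-vanish s<i) (powOneMinusExpNeg-vanish (ℕ.m≤n⇒m≤1+n s<i)) ⟩
  + suc i * 0ℤ
    ≡⟨ ℤ.*-zeroʳ (+ suc i) ⟩
  0ℤ ∎

sumTo-binomial-powOneMinusExpNeg : ∀ s q →
  sumTo s (λ i → binomial i q * powOneMinusExpNeg i s) ≡ facStirling2 q s
sumTo-binomial-powOneMinusExpNeg zero    zero    = refl
sumTo-binomial-powOneMinusExpNeg zero    (suc q) = refl
sumTo-binomial-powOneMinusExpNeg (suc s) q = begin
  sumTo (suc s) (λ i → binomial i q * P i (suc s))
    ≡⟨ sumTo-cong (suc s) (λ i _ → trans (cong (_*_ (binomial i q)) (powOneMinusExpNeg-suc i s))
                                         (spread (binomial i q) (+ i) (P (pred i) s) (P i s))) ⟩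
  sumTo (suc s) (λ i → + i * binomial i q * P (pred i) s - + i * binomial i q * P i s)
    ≡⟨ sumTo-- (suc s) _ _ ⟩
  sumTo (suc s) (λ i → + i * binomial i q * P (pred i) s) - sumTo (suc s) (λ i → + i * binomial i q * P i s)
    ≡⟨ cong₂ _-_ (trans (sumTo-suc s _) (ℤ.+-identityˡ (sumTo s (λ i → + suc i * binomial (suc i) q * P i s))))
                 (trans (cong (_+_ (sumTo s (λ i → + i * binomial i q * P i s))) top≡0)
                        (ℤ.+-identityʳ (sumTo s (λ i → + i * binomial i q * P i s)))) ⟩
  sumTo s (λ i → + suc i * binomial (suc i) q * P i s) - sumTo s (λ i → + i * binomial i q * P i s)
    ≡⟨ sym (sumTo-- s _ _) ⟩
  sumTo s (λ i → + suc i * binomial (suc i) q * P i s - + i * binomial i q * P i s)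
    ≡⟨ sumTo-cong s (λ i _ → trans (cong (λ b → b * P i s - + i * binomial i q * P i s) (sym (𝒟-binomial i q)))
                                    (collect (+ suc q) (binomial i q) (+ q) (binomial i (pred q)) (+ i) (P i s))) ⟩
  sumTo s (λ i → + suc q * (binomial i q * P i s) + + q * (binomial i (pred q) * P i s))
    ≡⟨ sumTo-linear s (+ suc q) (+ q) _ _ ⟩
  + suc q * sumTo s (λ i → binomial i q * P i s) + + q * sumTo s (λ i → binomial i (pred q) * P i s)
    ≡⟨ cong₂ (λ x y → + suc q * x + + q * y)
             (sumTo-binomial-powOneMinusExpNeg s q) (sumTo-binomial-powOneMinusExpNeg s (pred q)) ⟩
  facStirling2 q (suc s) ∎
  where
  P = powOneMinusExpNeg
  spread : ∀ B I x y → B * (I * (x - y)) ≡ I * B * x - I * B * y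
  spread = solve-∀
  collect : ∀ Q₁ A Q B I p → ((Q₁ * A + Q * B) + I * A) * p - I * A * p ≡ Q₁ * (A * p) + Q * (B * p)
  collect = solve-∀
  top≡0 : + suc s * binomial (suc s) q * P (suc s) s ≡ 0ℤ
  top≡0 = trans (cong (_*_ (+ suc s * binomial (suc s) q)) (powOneMinusExpNeg-vanish {suc s} ℕ.≤-refl))
                (ℤ.*-zeroʳ (+ suc s * binomial (suc s) q))

suc-^-facStirling2 : ∀ k i → (+ suc i) ^ k ≡ sumTo i (λ q → facStirling2 q k * binomial i q)
suc-^-facStirling2 zero    i = sym (sumTo-δ i (binomial i))
suc-^-facStirling2 (suc k) i = sym (begin
  sumTo i (λ q → 𝒟 (λ p → facStirling2 p k) q * binomial i q)
    ≡⟨ sumTo-𝒟-adjoint i (λ p → facStirling2 p k) (binomial i) boundary ⟩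
  sumTo i (λ q → facStirling2 q k * 𝒟ᵀ (binomial i) q)
    ≡⟨ sumTo-cong i (λ q _ → trans (cong (_*_ (facStirling2 q k)) (𝒟ᵀ-binomial i q))
                                    (shuffle (facStirling2 q k) (+ suc i) (binomial i q))) ⟩
  sumTo i (λ q → + suc i * (facStirling2 q k * binomial i q))
    ≡⟨ sumTo-*ˡ i (+ suc i) _ ⟩
  + suc i * sumTo i (λ q → facStirling2 q k * binomial i q)
    ≡⟨ cong (_*_ (+ suc i)) (sym (suc-^-facStirling2 k i)) ⟩
  + suc i * (+ suc i) ^ k ∎)
  where
  shuffle : ∀ x c y → x * (c * y) ≡ c * (x * y)
  shuffle = solve-∀
  boundary : facStirling2 i k * binomial i (suc i) ≡ 0ℤ
  boundary = trans (cong (_*_ (facStirling2 i k)) (binomial-vanish {i} ℕ.≤-refl)) (ℤ.*-zeroʳ (facStirling2 i k))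

liOverZ-facStirling2 : ∀ k s → liOverZ k s ≡ sumTo s (λ q → facStirling2 q k * facStirling2 q s)
liOverZ-facStirling2 k s = begin
  sumTo s (λ i → (+ suc i) ^ k * P i s)
    ≡⟨ sumTo-cong s (λ i i≤s → cong (_* P i s) (trans (suc-^-facStirling2 k i) (sym (extend i i≤s)))) ⟩
  sumTo s (λ i → sumTo s (λ q → facStirling2 q k * binomial i q) * P i s)
    ≡⟨ sumTo-cong s (λ i _ → sym (sumTo-*ʳ s (P i s) _)) ⟩
  sumTo s (λ i → sumTo s (λ q → facStirling2 q k * binomial i q * P i s))
    ≡⟨ sumTo-comm s s _ ⟩
  sumTo s (λ q → sumTo s (λ i → facStirling2 q k * binomial i q * P i s))
    ≡⟨ sumTo-cong s (λ q _ → trans (sumTo-cong s (λ i _ → ℤ.*-assoc (facStirling2 q k) (binomial i q) (P i s)))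
                                    (sumTo-*ˡ s (facStirling2 q k) _)) ⟩
  sumTo s (λ q → facStirling2 q k * sumTo s (λ i → binomial i q * P i s))
    ≡⟨ sumTo-cong s (λ q _ → cong (_*_ (facStirling2 q k)) (sumTo-binomial-powOneMinusExpNeg s q)) ⟩
  sumTo s (λ q → facStirling2 q k * facStirling2 q s) ∎
  where
  P = powOneMinusExpNeg
  extend : ∀ i → i ≤ s →
    sumTo s (λ q → facStirling2 q k * binomial i q) ≡ sumTo i (λ q → facStirling2 q k * binomial i q)
  extend i i≤s = sumTo-extend _ i≤s (λ q i<q →
    trans (cong (_*_ (facStirling2 q k)) (binomial-vanish i<q)) (ℤ.*-zeroʳ (facStirling2 q k)))

-- Poly-Bernoulli polynomials of negative index

polyBernoulliPart : ℤ → ℕ → ℕ → ℤ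
polyBernoulliPart x m q = egfMul (expNeg x) (facStirling2 q) m

polyBernoulliNeg-facStirling2 : ∀ k m x →
  polyBernoulliNeg k m x ≡ sumTo m (λ q → facStirling2 q k * polyBernoulliPart x m q)
polyBernoulliNeg-facStirling2 k m x =
  trans (egfMul-congʳ (expNeg x) m liOverZ-extended)
        (egfMul-sumToʳ (expNeg x) m (λ q → facStirling2 q k) facStirling2 m)
  where
  liOverZ-extended : ∀ s → s ≤ m → liOverZ k s ≡ sumTo m (λ q → facStirling2 q k * facStirling2 q s)
  liOverZ-extended s s≤m = trans (liOverZ-facStirling2 k s) (sym (sumTo-extend _ s≤m (λ q s<q →
    trans (cong (_*_ (facStirling2 q k)) (facStirling2-vanish s<q)) (ℤ.*-zeroʳ (facStirling2 q k)))))

polyBernoulliPart-vanish : ∀ x {m q} → m < q → polyBernoulliPart x m q ≡ 0ℤ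
polyBernoulliPart-vanish x {m} {q} m<q = sumTo-zero m _ (λ p _ →
  trans (cong (_*_ (+ (m C p) * expNeg x p)) (facStirling2-vanish (ℕ.≤-<-trans (ℕ.m∸n≤m m p) m<q)))
        (ℤ.*-zeroʳ (+ (m C p) * expNeg x p)))

polyBernoulliPart-zero : ∀ x q → polyBernoulliPart x 0 q ≡ δ q
polyBernoulliPart-zero x q = ℤ.*-identityˡ (δ q)

polyBernoulliPart-suc : ∀ x m q →
  polyBernoulliPart x (suc m) q ≡ - x * polyBernoulliPart x m q + 𝒟 (polyBernoulliPart x m) q
polyBernoulliPart-suc x m q =
  trans (egfMul-suc (expNeg x) (facStirling2 q) m)
        (cong₂ _+_ (egfMul-*ˡ (- x) (expNeg x) (facStirling2 q) m)
                   (egfMul-linearʳ (+ suc q) (+ q) (expNeg x) (facStirling2 q) (facStirling2 (pred q)) m (λ _ → refl)))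

binomialTransform : ℕ → (ℕ → ℤ) → ℕ → ℤ
binomialTransform n g k = sumTo n (λ c → binomial n c * g (k ℕ.+ c))

binomialTransform-δ : ∀ n k → binomialTransform n δ k ≡ δ k
binomialTransform-δ n zero    =
  trans (sumTo-cong n (λ c _ → ℤ.*-comm (binomial n c) (δ c))) (sumTo-δ n (binomial n))
binomialTransform-δ n (suc k) = sumTo-zero n _ (λ c _ → ℤ.*-zeroʳ (binomial n c))

binomialTransform-𝒟 : ∀ n g k →
  binomialTransform n (𝒟 g) k ≡ 𝒟 (binomialTransform n g) k + + n * binomialTransform n g k
binomialTransform-𝒟 n g k = begin
  sumTo n (λ c → C c * 𝒟 g (k ℕ.+ c))
    ≡⟨ sumTo-cong n (λ c _ → split (C c) (+ suc k) (+ k) (+ c) (a c) (b c)) ⟩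
  sumTo n (λ c → (+ suc k * (C c * a c) + + k * (C c * b c)) + + c * C c * (b c + a c))
    ≡⟨ sumTo-+ n _ _ ⟩
  sumTo n (λ c → + suc k * (C c * a c) + + k * (C c * b c)) + sumTo n (λ c → + c * C c * (b c + a c))
    ≡⟨ cong₂ _+_ (trans (sumTo-linear n (+ suc k) (+ k) _ _)
                        (cong (_+_ (+ suc k * binomialTransform n g k)) (lowered k)))
                 (sumTo-*-binomial-absorb n b a (λ c → cong (λ j → g (pred j)) (ℕ.+-suc k c))) ⟩
  𝒟 (binomialTransform n g) k + + n * binomialTransform n g k ∎
  where
  C = binomial n
  a b : ℕ → ℤ
  a c = g (k ℕ.+ c)
  b c = g (pred (k ℕ.+ c))
  split : ∀ B K₁ K c x y → B * ((K₁ + c) * x + (K + c) * y) ≡ (K₁ * (B * x) + K * (B * y)) + c * B * (y + x)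
  split = solve-∀
  lowered : ∀ k → + k * sumTo n (λ c → C c * g (pred (k ℕ.+ c))) ≡ + k * binomialTransform n g (pred k)
  lowered zero    = refl
  lowered (suc k) = refl

binomialTransform-𝒟ᵀ : ∀ n W k →
  binomialTransform n (𝒟ᵀ W) k ≡ 𝒟ᵀ (binomialTransform n W) k + + n * binomialTransform n W (suc k)
binomialTransform-𝒟ᵀ n W k = begin
  sumTo n (λ c → C c * 𝒟ᵀ W (k ℕ.+ c))
    ≡⟨ sumTo-cong n (λ c _ → split (C c) (+ suc k) (+ c) (a c) (a′ c)) ⟩
  sumTo n (λ c → + suc k * (C c * a c + C c * a′ c) + + c * C c * (a c + a′ c))
    ≡⟨ sumTo-+ n _ _ ⟩
  sumTo n (λ c → + suc k * (C c * a c + C c * a′ c)) + sumTo n (λ c → + c * C c * (a c + a′ c))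
    ≡⟨ cong₂ _+_ (trans (sumTo-*ˡ n (+ suc k) _) (cong (_*_ (+ suc k)) (sumTo-+ n _ _)))
                 (sumTo-*-binomial-absorb n a a′ (λ c → cong W (ℕ.+-suc k c))) ⟩
  𝒟ᵀ (binomialTransform n W) k + + n * binomialTransform n W (suc k) ∎
  where
  C = binomial n
  a a′ : ℕ → ℤ
  a c = W (k ℕ.+ c)
  a′ c = W (suc (k ℕ.+ c))
  split : ∀ B K₁ c x y → B * ((K₁ + c) * (x + y)) ≡ K₁ * (B * x + B * y) + c * B * (x + y)
  split = solve-∀

binomialTransform-polyBernoulliPart : ∀ n m k →
  binomialTransform n (polyBernoulliPart (+ n) m) k ≡ facStirling2 k m
binomialTransform-polyBernoulliPart n zero    k =
  trans (sumTo-cong n (λ c _ → cong (_*_ (binomial n c)) (polyBernoulliPart-zero (+ n) (k ℕ.+ c))))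
        (binomialTransform-δ n k)
binomialTransform-polyBernoulliPart n (suc m) k = begin
  sumTo n (λ c → binomial n c * polyBernoulliPart (+ n) (suc m) (k ℕ.+ c))
    ≡⟨ sumTo-cong n (λ c _ → trans (cong (_*_ (binomial n c)) (polyBernoulliPart-suc (+ n) m (k ℕ.+ c)))
                                    (ℤ.*-distribˡ-+ (binomial n c) _ _)) ⟩
  sumTo n (λ c → binomial n c * (- + n * P (k ℕ.+ c)) + binomial n c * 𝒟 P (k ℕ.+ c))
    ≡⟨ sumTo-+ n _ _ ⟩
  sumTo n (λ c → binomial n c * (- + n * P (k ℕ.+ c))) + binomialTransform n (𝒟 P) k
    ≡⟨ cong₂ _+_ (trans (sumTo-cong n (λ c _ → shuffle (binomial n c) (- + n) (P (k ℕ.+ c))))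
                        (sumTo-*ˡ n (- + n) _))
                 (binomialTransform-𝒟 n P k) ⟩
  - + n * binomialTransform n P k + (𝒟 (binomialTransform n P) k + + n * binomialTransform n P k)
    ≡⟨ cancel (+ n) (binomialTransform n P k) _ ⟩
  𝒟 (binomialTransform n P) k
    ≡⟨ 𝒟-cong (binomialTransform-polyBernoulliPart n m) k ⟩
  facStirling2 k (suc m) ∎
  where
  P = polyBernoulliPart (+ n) m
  shuffle : ∀ B c y → B * (c * y) ≡ c * (B * y)
  shuffle = solve-∀
  cancel : ∀ N X Y → - N * X + (Y + N * X) ≡ Y
  cancel = solve-∀

-- The Stirling-weighted sum

risingFactorial : ℕ → ℕ → ℤ
risingFactorial x zero    = + 1
risingFactorial x (suc n) = risingFactorial x n * + (x ℕ.+ n)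

risingFactorial-suc : ∀ x n → + x * risingFactorial (suc x) n ≡ risingFactorial x n * + (x ℕ.+ n)
risingFactorial-suc x zero    =
  trans (ℤ.*-identityʳ (+ x)) (sym (trans (ℤ.*-identityˡ (+ (x ℕ.+ 0))) (cong +_ (ℕ.+-identityʳ x))))
risingFactorial-suc x (suc n) = begin
  + x * (risingFactorial (suc x) n * + (suc x ℕ.+ n))
    ≡⟨ sym (ℤ.*-assoc (+ x) _ _) ⟩
  + x * risingFactorial (suc x) n * + (suc x ℕ.+ n)
    ≡⟨ cong₂ _*_ (risingFactorial-suc x n) (cong +_ (sym (ℕ.+-suc x n))) ⟩
  risingFactorial x n * + (x ℕ.+ n) * + (x ℕ.+ suc n) ∎

risingFactorial-binomialTransform-𝒟ᵀ : ∀ n W k →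
  risingFactorial (suc k) n * binomialTransform n (𝒟ᵀ W) k
    ≡ 𝒟ᵀ (λ j → risingFactorial (suc j) n * binomialTransform n W j) k
risingFactorial-binomialTransform-𝒟ᵀ n W k = begin
  R₁ * binomialTransform n (𝒟ᵀ W) k
    ≡⟨ cong (_*_ R₁) (binomialTransform-𝒟ᵀ n W k) ⟩
  R₁ * (+ suc k * (B₀ + B₁) + + n * B₁)
    ≡⟨ regroup R₁ (+ suc k) (+ n) B₀ B₁ ⟩
  + suc k * (R₁ * B₀) + R₁ * (+ suc k + + n) * B₁
    ≡⟨ cong (λ r → + suc k * (R₁ * B₀) + r * B₁) (sym (risingFactorial-suc (suc k) n)) ⟩
  + suc k * (R₁ * B₀) + + suc k * R₂ * B₁
    ≡⟨ collect (+ suc k) (R₁ * B₀) R₂ B₁ ⟩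
  + suc k * (R₁ * B₀ + R₂ * B₁) ∎
  where
  R₁ = risingFactorial (suc k) n
  R₂ = risingFactorial (suc (suc k)) n
  B₀ = binomialTransform n W k
  B₁ = binomialTransform n W (suc k)
  regroup : ∀ R K N x y → R * (K * (x + y) + N * y) ≡ K * (R * x) + R * (K + N) * y
  regroup = solve-∀
  collect : ∀ K u R y → K * u + K * R * y ≡ K * (u + R * y)
  collect = solve-∀

stirling1-vanish : ∀ {n j} → n < j → stirling1 n j ≡ 0
stirling1-vanish {zero}  {suc j} _ = refl
stirling1-vanish {suc n} {suc j} (s≤s n<j)
  rewrite stirling1-vanish n<j | stirling1-vanish (ℕ.m≤n⇒m≤1+n n<j) | ℕ.*-zeroʳ n = refl

stirling1-suc : ∀ n j → + stirling1 (suc n) (suc j) ≡ + stirling1 n j + + n * + stirling1 n (suc j)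
stirling1-suc n j = cong (_+_ (+ stirling1 n j)) (ℤ.pos-* n (stirling1 n (suc j)))

stirlingSum : ℕ → ℕ → ℕ → ℤ
stirlingSum n l q = sumTo n (λ j → + stirling1 n j * facStirling2 q (l ℕ.+ j))

stirlingSum-vanish : ∀ n l {q} → l ℕ.+ n < q → stirlingSum n l q ≡ 0ℤ
stirlingSum-vanish n l l+n<q = sumTo-zero n _ (λ j j≤n →
  trans (cong (_*_ (+ stirling1 n j)) (facStirling2-vanish (ℕ.≤-<-trans (ℕ.+-monoʳ-≤ l j≤n) l+n<q)))
        (ℤ.*-zeroʳ (+ stirling1 n j)))

stirlingSum-suc : ∀ n l q → stirlingSum n (suc l) q ≡ 𝒟 (stirlingSum n l) q
stirlingSum-suc n l q =
  trans (sumTo-cong n (λ j _ → spread (+ stirling1 n j) (+ suc q) (+ q) (facStirling2 q (l ℕ.+ j))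
                                      (facStirling2 (pred q) (l ℕ.+ j))))
        (sumTo-linear n (+ suc q) (+ q) _ _)
  where
  spread : ∀ s Q₁ Q x y → s * (Q₁ * x + Q * y) ≡ Q₁ * (s * x) + Q * (s * y)
  spread = solve-∀

*-sumTo-stirling1-suc : ∀ n (f : ℕ → ℤ) →
  + n * sumTo n (λ j → + stirling1 n j * f j) ≡ + n * sumTo n (λ j → + stirling1 n (suc j) * f (suc j))
*-sumTo-stirling1-suc n f = begin
  + n * sumTo n (λ j → + stirling1 n j * f j)
    ≡⟨ cong (_*_ (+ n)) (sumTo-shift n _ (cong (λ s → + s * f (suc n)) (stirling1-vanish {n} ℕ.≤-refl))) ⟩
  + n * (+ stirling1 n 0 * f 0 + Rest)
    ≡⟨ ℤ.*-distribˡ-+ (+ n) (+ stirling1 n 0 * f 0) Rest ⟩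
  + n * (+ stirling1 n 0 * f 0) + + n * Rest
    ≡⟨ trans (cong (_+ + n * Rest) (first≡0 n)) (ℤ.+-identityˡ (+ n * Rest)) ⟩
  + n * Rest ∎
  where
  Rest = sumTo n (λ j → + stirling1 n (suc j) * f (suc j))
  first≡0 : ∀ k → + k * (+ stirling1 k 0 * f 0) ≡ 0ℤ
  first≡0 zero    = refl
  first≡0 (suc k) = ℤ.*-zeroʳ (+ suc k)

stirlingSum-zero : ∀ n q → stirlingSum n 0 q ≡ risingFactorial 1 n * binomial n q
stirlingSum-zero zero    zero    = refl
stirlingSum-zero zero    (suc q) = refl
stirlingSum-zero (suc n) q = begin
  stirlingSum (suc n) 0 q
    ≡⟨ trans (sumTo-suc n _) (ℤ.+-identityˡ _) ⟩
  sumTo n (λ j → + stirling1 (suc n) (suc j) * E (suc j))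
    ≡⟨ sumTo-cong n (λ j _ → trans (cong (_* E (suc j)) (stirling1-suc n j))
                                    (ℤ.*-distribʳ-+ (E (suc j)) (+ stirling1 n j) (+ n * + stirling1 n (suc j)))) ⟩
  sumTo n (λ j → + stirling1 n j * E (suc j) + + n * + stirling1 n (suc j) * E (suc j))
    ≡⟨ sumTo-+ n _ _ ⟩
  stirlingSum n 1 q + sumTo n (λ j → + n * + stirling1 n (suc j) * E (suc j))
    ≡⟨ cong₂ _+_ (stirlingSum-suc n 0 q)
                 (trans (trans (sumTo-cong n (λ j _ → ℤ.*-assoc (+ n) _ _)) (sumTo-*ˡ n (+ n) _))
                        (sym (*-sumTo-stirling1-suc n E))) ⟩
  𝒟 (stirlingSum n 0) q + + n * stirlingSum n 0 q
    ≡⟨ cong₂ _+_ (𝒟-cong (stirlingSum-zero n) q) (cong (_*_ (+ n)) (stirlingSum-zero n q)) ⟩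
  𝒟 (λ p → R * binomial n p) q + + n * (R * binomial n q)
    ≡⟨ factor R (+ suc q) (+ q) (binomial n q) (binomial n (pred q)) (+ n) ⟩
  R * (𝒟 (binomial n) q + + n * binomial n q)
    ≡⟨ cong (_*_ R) (𝒟-binomial n q) ⟩
  R * (+ suc n * binomial (suc n) q)
    ≡⟨ sym (ℤ.*-assoc R (+ suc n) (binomial (suc n) q)) ⟩
  risingFactorial 1 (suc n) * binomial (suc n) q ∎
  where
  E = facStirling2 q
  R = risingFactorial 1 n
  factor : ∀ R Q₁ Q A B N → Q₁ * (R * A) + Q * (R * B) + N * (R * A) ≡ R * ((Q₁ * A + Q * B) + N * A)
  factor = solve-∀

stirlingSum-binomialTransform : ∀ n l M → l ℕ.+ n < M → ∀ W →
  sumTo M (λ q → stirlingSum n l q * W q)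
    ≡ sumTo M (λ k → facStirling2 k l * (risingFactorial (suc k) n * binomialTransform n W k))
stirlingSum-binomialTransform n zero M n<M W = begin
  sumTo M (λ q → stirlingSum n 0 q * W q)
    ≡⟨ sumTo-cong M (λ q _ → trans (cong (_* W q) (stirlingSum-zero n q)) (ℤ.*-assoc R (binomial n q) (W q))) ⟩
  sumTo M (λ q → R * (binomial n q * W q))
    ≡⟨ sumTo-*ˡ M R _ ⟩
  R * sumTo M (λ q → binomial n q * W q)
    ≡⟨ cong (_*_ R) (sumTo-extend _ (ℕ.<⇒≤ n<M) (λ q n<q → cong (_* W q) (binomial-vanish n<q))) ⟩
  R * binomialTransform n W 0
    ≡⟨ sym (sumTo-δ M (λ k → risingFactorial (suc k) n * binomialTransform n W k)) ⟩
  sumTo M (λ k → δ k * (risingFactorial (suc k) n * binomialTransform n W k)) ∎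
  where
  R = risingFactorial 1 n
stirlingSum-binomialTransform n (suc l) M 1+l+n<M W = begin
  sumTo M (λ q → stirlingSum n (suc l) q * W q)
    ≡⟨ sumTo-cong M (λ q _ → cong (_* W q) (stirlingSum-suc n l q)) ⟩
  sumTo M (λ q → 𝒟 (stirlingSum n l) q * W q)
    ≡⟨ sumTo-𝒟-adjoint M (stirlingSum n l) W (cong (_* W (suc M)) (stirlingSum-vanish n l l+n<M)) ⟩
  sumTo M (λ q → stirlingSum n l q * 𝒟ᵀ W q)
    ≡⟨ stirlingSum-binomialTransform n l M l+n<M (𝒟ᵀ W) ⟩
  sumTo M (λ k → facStirling2 k l * (risingFactorial (suc k) n * binomialTransform n (𝒟ᵀ W) k))
    ≡⟨ sumTo-cong M (λ k _ → cong (_*_ (facStirling2 k l)) (risingFactorial-binomialTransform-𝒟ᵀ n W k)) ⟩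
  sumTo M (λ k → facStirling2 k l * 𝒟ᵀ H k)
    ≡⟨ sym (sumTo-𝒟-adjoint M (λ p → facStirling2 p l) H
              (cong (_* H (suc M)) (facStirling2-vanish (ℕ.≤-<-trans (ℕ.m≤m+n l n) l+n<M)))) ⟩
  sumTo M (λ k → facStirling2 k (suc l) * H k) ∎
  where
  l+n<M : l ℕ.+ n < M
  l+n<M = ℕ.<⇒≤ 1+l+n<M
  H : ℕ → ℤ
  H k = risingFactorial (suc k) n * binomialTransform n W k

stirling1-polyBernoulliNeg-sum : ∀ l m n M → l ℕ.+ n < M → m ℕ.+ n < M →
  sumTo n (λ j → + stirling1 n j * polyBernoulliNeg (l ℕ.+ j) m (+ n))
    ≡ sumTo M (λ k → risingFactorial (suc k) n * (facStirling2 k l * facStirling2 k m))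
stirling1-polyBernoulliNeg-sum l m n M l+n<M m+n<M = begin
  sumTo n (λ j → + stirling1 n j * polyBernoulliNeg (l ℕ.+ j) m (+ n))
    ≡⟨ sumTo-cong n (λ j _ → trans (cong (_*_ (+ stirling1 n j)) (polyBernoulliNeg-facStirling2 (l ℕ.+ j) m (+ n)))
                                    (sym (sumTo-*ˡ m (+ stirling1 n j) _))) ⟩
  sumTo n (λ j → sumTo m (λ q → + stirling1 n j * (facStirling2 q (l ℕ.+ j) * P q)))
    ≡⟨ sumTo-comm n m _ ⟩
  sumTo m (λ q → sumTo n (λ j → + stirling1 n j * (facStirling2 q (l ℕ.+ j) * P q)))
    ≡⟨ sumTo-cong m (λ q _ → trans (sumTo-cong n (λ j _ → sym (ℤ.*-assoc (+ stirling1 n j) _ (P q))))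
                                    (sumTo-*ʳ n (P q) _)) ⟩
  sumTo m (λ q → stirlingSum n l q * P q)
    ≡⟨ sym (sumTo-extend _ m≤M (λ q m<q → trans (cong (_*_ (stirlingSum n l q))
                                                      (polyBernoulliPart-vanish (+ n) m<q))
                                                (ℤ.*-zeroʳ (stirlingSum n l q)))) ⟩
  sumTo M (λ q → stirlingSum n l q * P q)
    ≡⟨ stirlingSum-binomialTransform n l M l+n<M P ⟩
  sumTo M (λ k → facStirling2 k l * (risingFactorial (suc k) n * binomialTransform n P k))
    ≡⟨ sumTo-cong M (λ k _ → trans (cong (λ e → facStirling2 k l * (risingFactorial (suc k) n * e))
                                         (binomialTransform-polyBernoulliPart n m k))
                                   (shuffle (facStirling2 k l) (risingFactorial (suc k) n) (facStirling2 k m))) ⟩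
  sumTo M (λ k → risingFactorial (suc k) n * (facStirling2 k l * facStirling2 k m)) ∎
  where
  P = polyBernoulliPart (+ n) m
  m≤M : m ≤ M
  m≤M = ℕ.≤-trans (ℕ.m≤m+n m n) (ℕ.<⇒≤ m+n<M)
  shuffle : ∀ x r y → x * (r * y) ≡ r * (x * y)
  shuffle = solve-∀

corollary2p2 : (l m n : ℕ) →
    sumTo n (λ j → + stirling1 n j * polyBernoulliNeg (l Data.Nat.+ j) m (+ n))
      ≡ sumTo n (λ j → + stirling1 n j * polyBernoulliNeg (m Data.Nat.+ j) l (+ n))
corollary2p2 l m n = begin
  sumTo n (λ j → + stirling1 n j * polyBernoulliNeg (l ℕ.+ j) m (+ n))
    ≡⟨ stirling1-polyBernoulliNeg-sum l m n M l+n<M m+n<M ⟩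
  sumTo M (λ k → risingFactorial (suc k) n * (facStirling2 k l * facStirling2 k m))
    ≡⟨ sumTo-cong M (λ k _ → cong (_*_ (risingFactorial (suc k) n))
                                  (ℤ.*-comm (facStirling2 k l) (facStirling2 k m))) ⟩
  sumTo M (λ k → risingFactorial (suc k) n * (facStirling2 k m * facStirling2 k l))
    ≡⟨ sym (stirling1-polyBernoulliNeg-sum m l n M m+n<M l+n<M) ⟩
  sumTo n (λ j → + stirling1 n j * polyBernoulliNeg (m ℕ.+ j) l (+ n)) ∎
  where
  M = suc (l ℕ.+ n ℕ.+ (m ℕ.+ n))
  l+n<M : l ℕ.+ n < M
  l+n<M = s≤s (ℕ.m≤m+n (l ℕ.+ n) (m ℕ.+ n))
  m+n<M : m ℕ.+ n < M
  m+n<M = s≤s (ℕ.m≤n+m (m ℕ.+ n) (l ℕ.+ n))
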